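{- Let $t \geq 1$ and let $G$ be a connected $2t$-regular graph. Then $\mathcal{M}_3(G)$ is a nut graph.
   Context: $\mathcal{M}_3(G)$ is the graph obtained from $G$ by fusing a bouquet of $t$ triangles to every vertex of $G$: for each vertex $v$ of $G$ and each of $t$ copies, add two new vertices adjacent to each other and to $v$ (all new vertices distinct). Thus $|V(\mathcal{M}_3(G))| = (2t+1)|V(G)|$. A nut graph is a simple connected graph whose adjacency matrix has one-dimensional kernel spanned by a vector with no zero entry.
   Formalization: The kernel of the adjacency matrix of $\mathcal{M}_3(G)$, and the spanning vector with no zero entry, are taken over ℚ. -}

module Defs where

open import Data.Bool using (Bool; true; false; if_then_else_; _∧_; not)
open import Data.Nat as ℕ using (ℕ; zero; suc; ⌊_/2⌋)
open import Data.Fin as Fin using (Fin; zero; suc; toℕ; remQuot)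
open import Data.Product using (Σ; _×_; _,_; proj₁; proj₂)
open import Data.Rational as ℚ using (ℚ; 0ℚ; 1ℚ)
open import Relation.Binary.PropositionalEquality using (_≡_)
open import Relation.Nullary using (¬_; does)

Adj : ℕ → Set
Adj n = Fin n → Fin n → Bool

IsSimple : ∀ {n} → Adj n → Set
IsSimple {n} A = (∀ (u v : Fin n) → A u v ≡ A v u) × (∀ (u : Fin n) → A u u ≡ false)

data Walk {n : ℕ} (A : Adj n) : Fin n → Fin n → Set where
  here : ∀ {u} → Walk A u u
  step : ∀ {u w v} → A u w ≡ true → Walk A w v → Walk A u v

IsConnected : ∀ {n} → Adj n → Set
IsConnected {n} A = ∀ (u v : Fin n) → Walk A u v

sumℕ : ∀ {n} → (Fin n → ℕ) → ℕ
sumℕ {zero}  f = 0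
sumℕ {suc n} f = f zero ℕ.+ sumℕ (λ i → f (suc i))

sumℚ : ∀ {n} → (Fin n → ℚ) → ℚ
sumℚ {zero}  f = 0ℚ
sumℚ {suc n} f = f zero ℚ.+ sumℚ (λ i → f (suc i))

degree : ∀ {n} → Adj n → Fin n → ℕ
degree A u = sumℕ (λ v → if A u v then 1 else 0)

IsRegular : ∀ {n} → ℕ → Adj n → Set
IsRegular {n} d A = ∀ (u : Fin n) → degree A u ≡ d

adjMatrix : ∀ {n} → Adj n → Fin n → Fin n → ℚ
adjMatrix A u v = if A u v then 1ℚ else 0ℚ

InKernel : ∀ {n} → Adj n → (Fin n → ℚ) → Set
InKernel A x = ∀ u → sumℚ (λ v → adjMatrix A u v ℚ.* x v) ≡ 0ℚ

-- Nut graph: simple, connected, and the kernel of the adjacency matrix is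
-- exactly the span of a single vector x with no zero entry (so it is
-- one-dimensional, x being nonzero).
IsNut : ∀ {n} → Adj n → Set
IsNut {n} A =
  IsSimple A × IsConnected A ×
  Σ (Fin n → ℚ) λ x →
    (∀ u → ¬ (x u ≡ 0ℚ)) × InKernel A x ×
    (∀ (y : Fin n → ℚ) → InKernel A y → Σ ℚ λ c → ∀ u → y u ≡ c ℚ.* x u)

-- M₃(G): vertex set Fin (n * (1 + 2t)); vertex k decodes via remQuot as
-- (v , j) with v : Fin n, j : Fin (1 + 2t).  j = 0 is the original vertex v;
-- j = suc j' (j' < 2t) is a new vertex in the triangle number ⌊ j' / 2 ⌋
-- attached at v.
same : ∀ {m} → Fin m → Fin m → Bool
same a b = does (a Fin.≟ b)

M3adj : ∀ {n} (t : ℕ) → Adj n → Fin n × Fin (suc (2 ℕ.* t)) → Fin n × Fin (suc (2 ℕ.* t)) → Bool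
M3adj t A (v , zero)   (w , zero)   = A v w
M3adj t A (v , zero)   (w , suc _)  = same v w
M3adj t A (v , suc _)  (w , zero)   = same v w
M3adj t A (v , suc j)  (w , suc k)  =
  same v w ∧ (does (⌊ toℕ j /2⌋ ℕ.≟ ⌊ toℕ k /2⌋) ∧ not (same j k))

M3 : ∀ {n} (t : ℕ) → Adj n → Adj (n ℕ.* suc (2 ℕ.* t))
M3 {n} t A a b = M3adj t A (remQuot (suc (2 ℕ.* t)) a) (remQuot (suc (2 ℕ.* t)) b)

{-# OPTIONS --safe #-}
module Submission where

-- At a triangle vertex the kernel equation of M₃(G) says that the hub value plus the value at the
-- other vertex of the triangle vanishes, so all triangle vertices at v carry −y(v). The equation at
-- the hub v then reads Σ_{w∼v} y(w) = 2t·y(v) = deg(v)·y(v): the hub values form a harmonic function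
-- on G, which is constant on a connected graph by the maximum principle. Hence the kernel is spanned
-- by the vector that is 1 at hubs and −1 at triangle vertices, and this vector lies in the kernel
-- since constants are harmonic.

open import Defs
open import Algebra.Bundles using (CommutativeRing)
import Algebra.Properties.Group as GroupProperties
import Algebra.Properties.Semiring.Sum as SemiringSum
open import Data.Bool using (Bool; true; false; if_then_else_; _∧_; not)
open import Data.Bool.Properties using (∧-zeroʳ)
open import Data.Fin as Fin using (Fin; zero; suc; toℕ; fromℕ<; remQuot; combine; _↑ˡ_; _↑ʳ_)
open import Data.Fin.Properties using (toℕ-fromℕ<; toℕ-injective; toℕ<n; remQuot-combine; combine-remQuot)
open import Data.Nat as ℕ using (ℕ; zero; suc; _≤_; _*_; z≤n; s≤s; ⌊_/2⌋)
open import Data.Nat.Properties using (*-suc)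
open import Data.Product using (Σ; ∃; _×_; _,_; proj₁; proj₂; uncurry)
open import Data.Rational as ℚ using (ℚ; 0ℚ; 1ℚ; _+_; -_; _-_)
open import Data.Rational.Properties as ℚP using (+-*-commutativeRing; +-0-group)
open import Data.Rational.Solver using (module +-*-Solver)
open import Data.Sum using (inj₁; inj₂)
open import Function using (_∘_; mk⇔)
open import Relation.Binary.PropositionalEquality
open import Relation.Nullary using (¬_; does)
open import Relation.Nullary.Decidable using (dec-true; does-⇔)

private
  module ∑ = SemiringSum (CommutativeRing.semiring +-*-commutativeRing)
  module ℚGroup = GroupProperties +-0-group

indicator : Bool → ℚ
indicator b = if b then 1ℚ else 0ℚ

indicator-∧ : ∀ a b → indicator (a ∧ b) ≡ indicator a ℚ.* indicator b
indicator-∧ true  b = sym (ℚP.*-identityˡ (indicator b))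
indicator-∧ false b = sym (ℚP.*-zeroˡ (indicator b))

count : ∀ {N} → (Fin N → Bool) → ℕ
count b = sumℕ (λ i → if b i then 1 else 0)

sumℚ≡sum : ∀ {N} (f : Fin N → ℚ) → sumℚ f ≡ ∑.sum f
sumℚ≡sum {zero}  f = refl
sumℚ≡sum {suc N} f = cong (f zero +_) (sumℚ≡sum (f ∘ suc))

sumℚ-cong : ∀ {N} {f g : Fin N → ℚ} → (∀ i → f i ≡ g i) → sumℚ f ≡ sumℚ g
sumℚ-cong {zero}  f≗g = refl
sumℚ-cong {suc N} f≗g = cong₂ _+_ (f≗g zero) (sumℚ-cong (f≗g ∘ suc))

sumℚ-distrib-+ : ∀ {N} (f g : Fin N → ℚ) → sumℚ (λ i → f i + g i) ≡ sumℚ f + sumℚ g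
sumℚ-distrib-+ {N} f g = begin
  sumℚ (λ i → f i + g i)       ≡⟨ sumℚ≡sum (λ i → f i + g i) ⟩
  ∑.sum {N} (λ i → f i + g i)  ≡⟨ ∑.∑-distrib-+ f g ⟩
  ∑.sum f + ∑.sum g            ≡⟨ sym (cong₂ _+_ (sumℚ≡sum f) (sumℚ≡sum g)) ⟩
  sumℚ f + sumℚ g              ∎
  where open ≡-Reasoning

*-distribˡ-sumℚ : ∀ {N} c (f : Fin N → ℚ) → c ℚ.* sumℚ f ≡ sumℚ (λ i → c ℚ.* f i)
*-distribˡ-sumℚ {N} c f = begin
  c ℚ.* sumℚ f                 ≡⟨ cong (c ℚ.*_) (sumℚ≡sum f) ⟩
  c ℚ.* ∑.sum f                ≡⟨ ∑.*-distribˡ-sum c f ⟩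
  ∑.sum {N} (λ i → c ℚ.* f i)  ≡⟨ sym (sumℚ≡sum (λ i → c ℚ.* f i)) ⟩
  sumℚ (λ i → c ℚ.* f i)       ∎
  where open ≡-Reasoning

sumℚ-zero : ∀ N → sumℚ {N} (λ _ → 0ℚ) ≡ 0ℚ
sumℚ-zero N = trans (sumℚ≡sum {N} _) (∑.sum-replicate-zero N)

sumℚ-neg : ∀ {N} (f : Fin N → ℚ) → sumℚ (λ i → - f i) ≡ - sumℚ f
sumℚ-neg {zero}  f = refl
sumℚ-neg {suc N} f =
  trans (cong (- f zero +_) (sumℚ-neg (f ∘ suc))) (sym (ℚP.neg-distrib-+ (f zero) _))

sumℚ-++ : ∀ m n (f : Fin (m ℕ.+ n) → ℚ) →
          sumℚ f ≡ sumℚ (λ i → f (i ↑ˡ n)) + sumℚ (λ j → f (m ↑ʳ j))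
sumℚ-++ zero    n f = sym (ℚP.+-identityˡ _)
sumℚ-++ (suc m) n f =
  trans (cong (f zero +_) (sumℚ-++ m n (f ∘ suc))) (sym (ℚP.+-assoc (f zero) _ _))

sumℚ-combine : ∀ m n (f : Fin (m * n) → ℚ) →
               sumℚ f ≡ sumℚ (λ i → sumℚ (λ j → f (combine {m} {n} i j)))
sumℚ-combine zero    n f = refl
sumℚ-combine (suc m) n f =
  trans (sumℚ-++ n (m * n) f)
        (cong (sumℚ (λ j → f (j ↑ˡ m * n)) +_) (sumℚ-combine m n (f ∘ (n ↑ʳ_))))

sumℚ-same : ∀ {N} (i : Fin N) (f : Fin N → ℚ) → sumℚ (λ j → indicator (same i j) ℚ.* f j) ≡ f i
sumℚ-same {suc N} zero f = begin
  1ℚ ℚ.* f zero + sumℚ (λ j → 0ℚ ℚ.* f (suc j))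
    ≡⟨ cong₂ _+_ (ℚP.*-identityˡ (f zero)) (sumℚ-cong (λ j → ℚP.*-zeroˡ (f (suc j)))) ⟩
  f zero + sumℚ {N} (λ _ → 0ℚ)  ≡⟨ cong (f zero +_) (sumℚ-zero N) ⟩
  f zero + 0ℚ                    ≡⟨ ℚP.+-identityʳ _ ⟩
  f zero                         ∎
  where open ≡-Reasoning
sumℚ-same {suc N} (suc i) f =
  trans (cong₂ _+_ (ℚP.*-zeroˡ (f zero)) (sumℚ-same i (f ∘ suc))) (ℚP.+-identityˡ _)

sumℚ-indicator-const : ∀ {N} (b : Fin N → Bool) c →
                       sumℚ (λ i → indicator (b i) ℚ.* c) ≡ sumℚ {count b} (λ _ → c)
sumℚ-indicator-const {zero}  b c = refl
sumℚ-indicator-const {suc N} b c with b zero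
... | true  = cong₂ _+_ (ℚP.*-identityˡ c) (sumℚ-indicator-const (b ∘ suc) c)
... | false = trans (cong₂ _+_ (ℚP.*-zeroˡ c) (sumℚ-indicator-const (b ∘ suc) c)) (ℚP.+-identityˡ _)

indicator-*-nonNeg : ∀ b {d} → 0ℚ ℚ.≤ d → 0ℚ ℚ.≤ indicator b ℚ.* d
indicator-*-nonNeg true  {d} 0≤d = subst (0ℚ ℚ.≤_) (sym (ℚP.*-identityˡ d)) 0≤d
indicator-*-nonNeg false {d} 0≤d = ℚP.≤-reflexive (sym (ℚP.*-zeroˡ d))

p≤q⇒0≤q-p : ∀ {p q} → p ℚ.≤ q → 0ℚ ℚ.≤ q - p
p≤q⇒0≤q-p {p} {q} p≤q = subst (ℚ._≤ q - p) (ℚP.+-inverseʳ p) (ℚP.+-monoˡ-≤ (- p) p≤q)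

sumℚ-nonNeg : ∀ {N} {f : Fin N → ℚ} → (∀ i → 0ℚ ℚ.≤ f i) → 0ℚ ℚ.≤ sumℚ f
sumℚ-nonNeg {zero}  0≤f = ℚP.≤-refl
sumℚ-nonNeg {suc N} 0≤f = ℚP.+-mono-≤ (0≤f zero) (sumℚ-nonNeg (0≤f ∘ suc))

nonNeg+nonNeg≡0⇒≡0 : ∀ {p q} → 0ℚ ℚ.≤ p → 0ℚ ℚ.≤ q → p + q ≡ 0ℚ → p ≡ 0ℚ
nonNeg+nonNeg≡0⇒≡0 {p} {q} 0≤p 0≤q p+q≡0 = ℚP.≤-antisym p≤0 0≤p
  where
  p≤0 : p ℚ.≤ 0ℚ
  p≤0 = subst₂ ℚ._≤_ (ℚP.+-identityʳ p) p+q≡0 (ℚP.+-monoʳ-≤ p 0≤q)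

sumℚ-nonNeg≡0 : ∀ {N} {f : Fin N → ℚ} → (∀ i → 0ℚ ℚ.≤ f i) → sumℚ f ≡ 0ℚ → ∀ i → f i ≡ 0ℚ
sumℚ-nonNeg≡0 {suc N} 0≤f sum≡0 zero    =
  nonNeg+nonNeg≡0⇒≡0 (0≤f zero) (sumℚ-nonNeg (0≤f ∘ suc)) sum≡0
sumℚ-nonNeg≡0 {suc N} {f} 0≤f sum≡0 (suc i) = sumℚ-nonNeg≡0 (0≤f ∘ suc)
  (nonNeg+nonNeg≡0⇒≡0 (sumℚ-nonNeg (0≤f ∘ suc)) (0≤f zero) (trans (ℚP.+-comm _ (f zero)) sum≡0)) i

max-attained : ∀ {N} (f : Fin (suc N) → ℚ) → ∃ λ m → ∀ i → f i ℚ.≤ f m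
max-attained {zero}  f = zero , λ { zero → ℚP.≤-refl }
max-attained {suc N} f with max-attained (f ∘ suc)
... | m , f≤fm with ℚP.≤-total (f zero) (f (suc m))
...   | inj₁ f0≤fm = suc m , λ { zero → f0≤fm ; (suc i) → f≤fm i }
...   | inj₂ fm≤f0 = zero , λ { zero → ℚP.≤-refl ; (suc i) → ℚP.≤-trans (f≤fm i) fm≤f0 }

Walk-preserves : ∀ {n} {A : Adj n} (P : Fin n → Set) → (∀ {u w} → A u w ≡ true → P u → P w) →
                 ∀ {u w} → Walk A u w → P u → P w
Walk-preserves P along here        = λ Pu → Pu
Walk-preserves P along (step e uw) = Walk-preserves P along uw ∘ along e

Walk-append : ∀ {n} {A : Adj n} {u v w} → Walk A u v → Walk A v w → Walk A u w
Walk-append here        vw = vw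
Walk-append (step e uv) vw = step e (Walk-append uv vw)

IsHarmonic : ∀ {n} → Adj n → (Fin n → ℚ) → Set
IsHarmonic A z = ∀ v → sumℚ (λ w → adjMatrix A v w ℚ.* (z v - z w)) ≡ 0ℚ

harmonic-max-spreads : ∀ {n} {A : Adj n} {z : Fin n → ℚ} → IsHarmonic A z →
                       ∀ {u w} → (∀ v → z v ℚ.≤ z u) → A u w ≡ true → z w ≡ z u
harmonic-max-spreads {A = A} {z} harmonic {u} {w} z≤zu uw = sym (ℚGroup.x∙y⁻¹≈ε⇒x≈y (z u) (z w) zu-zw≡0)
  where
  terms≡0 : ∀ v → adjMatrix A u v ℚ.* (z u - z v) ≡ 0ℚ
  terms≡0 = sumℚ-nonNeg≡0
    (λ v → indicator-*-nonNeg (A u v) (p≤q⇒0≤q-p (z≤zu v))) (harmonic u)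
  zu-zw≡0 : z u - z w ≡ 0ℚ
  zu-zw≡0 = begin
    z u - z w                               ≡⟨ sym (ℚP.*-identityˡ _) ⟩
    indicator true ℚ.* (z u - z w)          ≡⟨ cong (λ b → indicator b ℚ.* (z u - z w)) (sym uw) ⟩
    adjMatrix A u w ℚ.* (z u - z w)         ≡⟨ terms≡0 w ⟩
    0ℚ                                      ∎
    where open ≡-Reasoning

harmonic⇒constant : ∀ {n} {A : Adj n} {z : Fin n → ℚ} → IsConnected A → IsHarmonic A z →
                    ∀ u w → z u ≡ z w
harmonic⇒constant {suc n} {A} {z} connected harmonic u w = trans (atMax u) (sym (atMax w))
  where
  m : Fin (suc n)
  m = proj₁ (max-attained z)

  z≤zm : ∀ v → z v ℚ.≤ z m
  z≤zm = proj₂ (max-attained z)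

  spreads : ∀ {u w} → A u w ≡ true → z u ≡ z m → z w ≡ z m
  spreads uw zu≡zm = trans
    (harmonic-max-spreads {A = A} harmonic (λ v → subst (z v ℚ.≤_) (sym zu≡zm) (z≤zm v)) uw)
    zu≡zm

  atMax : ∀ v → z v ≡ z m
  atMax v = Walk-preserves {A = A} (λ v → z v ≡ z m) spreads (connected m v) refl

constant-harmonic : ∀ {n} (A : Adj n) c → IsHarmonic A (λ _ → c)
constant-harmonic {n} A c v = trans
  (sumℚ-cong (λ w → trans (cong (adjMatrix A v w ℚ.*_) (ℚP.+-inverseʳ c)) (ℚP.*-zeroʳ (adjMatrix A v w))))
  (sumℚ-zero n)

laplacian-regular : ∀ {d n} {A : Adj n} → IsRegular d A → ∀ (z : Fin n → ℚ) v →
                    sumℚ (λ w → adjMatrix A v w ℚ.* (z v - z w))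
                    ≡ sumℚ {d} (λ _ → z v) - sumℚ (λ w → adjMatrix A v w ℚ.* z w)
laplacian-regular {d} {A = A} regular z v = begin
  sumℚ (λ w → adjMatrix A v w ℚ.* (z v - z w))
    ≡⟨ sumℚ-cong (λ w → ℚP.*-distribˡ-+ (adjMatrix A v w) (z v) (- z w)) ⟩
  sumℚ (λ w → adjMatrix A v w ℚ.* z v + adjMatrix A v w ℚ.* - z w)
    ≡⟨ sumℚ-distrib-+ (λ w → adjMatrix A v w ℚ.* z v) _ ⟩
  sumℚ (λ w → adjMatrix A v w ℚ.* z v) + sumℚ (λ w → adjMatrix A v w ℚ.* - z w)
    ≡⟨ cong₂ _+_ (sumℚ-indicator-const (A v) (z v))
                 (sumℚ-cong (λ w → sym (ℚP.neg-distribʳ-* (adjMatrix A v w) (z w)))) ⟩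
  sumℚ {degree A v} (λ _ → z v) + sumℚ (λ w → - (adjMatrix A v w ℚ.* z w))
    ≡⟨ cong₂ _+_ (cong (λ k → sumℚ {k} (λ _ → z v)) (regular v)) (sumℚ-neg (λ w → adjMatrix A v w ℚ.* z w)) ⟩
  sumℚ {d} (λ _ → z v) - sumℚ (λ w → adjMatrix A v w ℚ.* z w) ∎
  where open ≡-Reasoning

twinℕ : ℕ → ℕ
twinℕ 0 = 1
twinℕ 1 = 0
twinℕ (suc (suc a)) = suc (suc (twinℕ a))

twinℕ-involutive : ∀ a → twinℕ (twinℕ a) ≡ a
twinℕ-involutive 0 = refl
twinℕ-involutive 1 = refl
twinℕ-involutive (suc (suc a)) = cong (λ b → 2 ℕ.+ b) (twinℕ-involutive a)

twinℕ-< : ∀ {t a} → a ℕ.< 2 * t → twinℕ a ℕ.< 2 * t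
twinℕ-< {suc t} {a} a<2t rewrite *-suc 2 t = twin-<-2+ a a<2t
  where
  twin-<-2+ : ∀ a → a ℕ.< 2 ℕ.+ 2 * t → twinℕ a ℕ.< 2 ℕ.+ 2 * t
  twin-<-2+ 0 _ = s≤s (s≤s z≤n)
  twin-<-2+ 1 _ = s≤s z≤n
  twin-<-2+ (suc (suc a)) (s≤s (s≤s a<2t)) = s≤s (s≤s (twinℕ-< {t} a<2t))

sameHalf∧≢≡twinℕ : ∀ a b → (does (⌊ a /2⌋ ℕ.≟ ⌊ b /2⌋) ∧ not (does (a ℕ.≟ b))) ≡ does (twinℕ a ℕ.≟ b)
sameHalf∧≢≡twinℕ 0 0 = refl
sameHalf∧≢≡twinℕ 0 1 = refl
sameHalf∧≢≡twinℕ 0 (suc (suc b)) = refl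
sameHalf∧≢≡twinℕ 1 0 = refl
sameHalf∧≢≡twinℕ 1 1 = refl
sameHalf∧≢≡twinℕ 1 (suc (suc b)) = refl
sameHalf∧≢≡twinℕ (suc (suc a)) 0 = refl
sameHalf∧≢≡twinℕ (suc (suc a)) 1 = refl
sameHalf∧≢≡twinℕ (suc (suc a)) (suc (suc b)) = sameHalf∧≢≡twinℕ a b

twin : ∀ t → Fin (2 * t) → Fin (2 * t)
twin t i = fromℕ< (twinℕ-< {t} (toℕ<n i))

toℕ-twin : ∀ t (i : Fin (2 * t)) → toℕ (twin t i) ≡ twinℕ (toℕ i)
toℕ-twin t i = toℕ-fromℕ< (twinℕ-< {t} (toℕ<n i))

twin-involutive : ∀ t (i : Fin (2 * t)) → twin t (twin t i) ≡ i
twin-involutive t i = toℕ-injective (begin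
  toℕ (twin t (twin t i))  ≡⟨ toℕ-twin t (twin t i) ⟩
  twinℕ (toℕ (twin t i))   ≡⟨ cong twinℕ (toℕ-twin t i) ⟩
  twinℕ (twinℕ (toℕ i))    ≡⟨ twinℕ-involutive (toℕ i) ⟩
  toℕ i                    ∎)
  where open ≡-Reasoning

same-refl : ∀ {m} (i : Fin m) → same i i ≡ true
same-refl i = dec-true (i Fin.≟ i) refl

same-sym : ∀ {m} (i j : Fin m) → same i j ≡ same j i
same-sym i j = does-⇔ (mk⇔ sym sym) (i Fin.≟ j) (j Fin.≟ i)

same≡toℕ-≟ : ∀ {m} (i j : Fin m) → same i j ≡ does (toℕ i ℕ.≟ toℕ j)
same≡toℕ-≟ i j = does-⇔ (mk⇔ (cong toℕ) toℕ-injective) (i Fin.≟ j) (toℕ i ℕ.≟ toℕ j)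

M3adj-pendant : ∀ t {n} (A : Adj n) v w (i k : Fin (2 * t)) →
                M3adj t A (v , suc i) (w , suc k) ≡ same v w ∧ same (twin t i) k
M3adj-pendant t A v w i k = cong (same v w ∧_) (begin
  does (⌊ toℕ i /2⌋ ℕ.≟ ⌊ toℕ k /2⌋) ∧ not (same i k)
    ≡⟨ cong (λ b → does (⌊ toℕ i /2⌋ ℕ.≟ ⌊ toℕ k /2⌋) ∧ not b) (same≡toℕ-≟ i k) ⟩
  does (⌊ toℕ i /2⌋ ℕ.≟ ⌊ toℕ k /2⌋) ∧ not (does (toℕ i ℕ.≟ toℕ k))
    ≡⟨ sameHalf∧≢≡twinℕ (toℕ i) (toℕ k) ⟩
  does (twinℕ (toℕ i) ℕ.≟ toℕ k)
    ≡⟨ cong (λ a → does (a ℕ.≟ toℕ k)) (sym (toℕ-twin t i)) ⟩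
  does (toℕ (twin t i) ℕ.≟ toℕ k)
    ≡⟨ sym (same≡toℕ-≟ (twin t i) k) ⟩
  same (twin t i) k ∎)
  where open ≡-Reasoning

hubSign : ∀ {k} → Fin (suc k) → ℚ
hubSign zero    = 1ℚ
hubSign (suc _) = - 1ℚ

module _ (t : ℕ) {n : ℕ} (A : Adj n) where

  private
    m : ℕ
    m = suc (2 * t)

  ∀-combine : {P : Fin (n * m) → Set} → (∀ v i → P (combine v i)) → ∀ u → P u
  ∀-combine {P} P-combine u = subst P (combine-remQuot {n} m u) (uncurry P-combine (remQuot {n} m u))

  M3-combine : ∀ v i w j → M3 t A (combine v i) (combine w j) ≡ M3adj t A (v , i) (w , j)
  M3-combine v i w j = cong₂ (M3adj t A) (remQuot-combine v i) (remQuot-combine w j)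

  M3adj-sym : (∀ v w → A v w ≡ A w v) → ∀ p q → M3adj t A p q ≡ M3adj t A q p
  M3adj-sym A-sym (v , zero)  (w , zero)  = A-sym v w
  M3adj-sym A-sym (v , zero)  (w , suc _) = same-sym v w
  M3adj-sym A-sym (v , suc _) (w , zero)  = same-sym v w
  M3adj-sym A-sym (v , suc j) (w , suc k) = cong₂ _∧_ (same-sym v w)
    (cong₂ _∧_ (does-⇔ (mk⇔ sym sym) (⌊ toℕ j /2⌋ ℕ.≟ ⌊ toℕ k /2⌋) (⌊ toℕ k /2⌋ ℕ.≟ ⌊ toℕ j /2⌋))
               (cong not (same-sym j k)))

  M3adj-irrefl : (∀ v → A v v ≡ false) → ∀ p → M3adj t A p p ≡ false
  M3adj-irrefl A-irrefl (v , zero)  = A-irrefl v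
  M3adj-irrefl A-irrefl (v , suc j) rewrite same-refl j = trans (cong (same v v ∧_) (∧-zeroʳ _)) (∧-zeroʳ _)

  M3-simple : IsSimple A → IsSimple (M3 t A)
  M3-simple (A-sym , A-irrefl) =
    (λ a b → M3adj-sym A-sym (remQuot {n} m a) (remQuot {n} m b)) ,
    (λ a → M3adj-irrefl A-irrefl (remQuot {n} m a))

  M3-connected : IsConnected A → IsConnected (M3 t A)
  M3-connected connected = ∀-combine λ v i → ∀-combine λ w j →
    Walk-append (toHub v i) (Walk-append (lift (connected v w)) (fromHub w j))
    where
    edge : ∀ {v i w j} → M3adj t A (v , i) (w , j) ≡ true → M3 t A (combine v i) (combine w j) ≡ true
    edge {v} {i} {w} {j} = trans (M3-combine v i w j)

    toHub : ∀ v i → Walk (M3 t A) (combine v i) (combine v zero)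
    toHub v zero    = here
    toHub v (suc i) = step (edge (same-refl v)) here

    fromHub : ∀ v i → Walk (M3 t A) (combine v zero) (combine v i)
    fromHub v zero    = here
    fromHub v (suc i) = step (edge (same-refl v)) here

    lift : ∀ {v w} → Walk A v w → Walk (M3 t A) (combine v zero) (combine w zero)
    lift here       = here
    lift (step e p) = step (edge e) (lift p)

  row : Fin n × Fin m → (Fin n → Fin m → ℚ) → ℚ
  row p Y = sumℚ (λ w → sumℚ (λ j → indicator (M3adj t A p (w , j)) ℚ.* Y w j))

  row-cong : ∀ p {Y Y′} → (∀ w j → Y w j ≡ Y′ w j) → row p Y ≡ row p Y′
  row-cong p Y≗Y′ = sumℚ-cong λ w → sumℚ-cong λ j → cong (indicator (M3adj t A p (w , j)) ℚ.*_) (Y≗Y′ w j)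

  M3-row : ∀ (y : Fin (n * m) → ℚ) v i →
           sumℚ (λ b → adjMatrix (M3 t A) (combine v i) b ℚ.* y b) ≡ row (v , i) (λ w j → y (combine w j))
  M3-row y v i = trans (sumℚ-combine n m _) (sumℚ-cong λ w → sumℚ-cong λ j →
    cong (λ b → indicator b ℚ.* y (combine w j)) (M3-combine v i w j))

  row-hub : ∀ v Y →
            row (v , zero) Y ≡ sumℚ (λ w → adjMatrix A v w ℚ.* Y w zero) + sumℚ (λ k → Y v (suc k))
  row-hub v Y = begin
    sumℚ (λ w → adjMatrix A v w ℚ.* Y w zero + sumℚ (λ k → δ w ℚ.* Y w (suc k)))
      ≡⟨ sumℚ-distrib-+ (λ w → adjMatrix A v w ℚ.* Y w zero) _ ⟩
    S + sumℚ (λ w → sumℚ (λ k → δ w ℚ.* Y w (suc k)))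
      ≡⟨ cong (S +_) (sumℚ-cong (λ w → sym (*-distribˡ-sumℚ (δ w) (Y w ∘ suc)))) ⟩
    S + sumℚ (λ w → δ w ℚ.* sumℚ (Y w ∘ suc))
      ≡⟨ cong (S +_) (sumℚ-same v (λ w → sumℚ (Y w ∘ suc))) ⟩
    S + sumℚ (λ k → Y v (suc k)) ∎
    where
    open ≡-Reasoning
    δ : Fin n → ℚ
    δ w = indicator (same v w)
    S : ℚ
    S = sumℚ (λ w → adjMatrix A v w ℚ.* Y w zero)

  row-pendant : ∀ v i Y → row (v , suc i) Y ≡ Y v zero + Y v (suc (twin t i))
  row-pendant v i Y = begin
    sumℚ (λ w → δ w ℚ.* Y w zero + sumℚ (λ k → indicator (M3adj t A (v , suc i) (w , suc k)) ℚ.* Y w (suc k)))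
      ≡⟨ sumℚ-cong (λ w → cong (δ w ℚ.* Y w zero +_) (pendants w)) ⟩
    sumℚ (λ w → δ w ℚ.* Y w zero + δ w ℚ.* Y w (suc (twin t i)))
      ≡⟨ sumℚ-cong (λ w → sym (ℚP.*-distribˡ-+ (δ w) _ _)) ⟩
    sumℚ (λ w → δ w ℚ.* (Y w zero + Y w (suc (twin t i))))
      ≡⟨ sumℚ-same v _ ⟩
    Y v zero + Y v (suc (twin t i)) ∎
    where
    open ≡-Reasoning
    δ : Fin n → ℚ
    δ w = indicator (same v w)

    pendants : ∀ w → sumℚ (λ k → indicator (M3adj t A (v , suc i) (w , suc k)) ℚ.* Y w (suc k))
                     ≡ δ w ℚ.* Y w (suc (twin t i))
    pendants w = begin
      sumℚ (λ k → indicator (M3adj t A (v , suc i) (w , suc k)) ℚ.* Y w (suc k))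
        ≡⟨ sumℚ-cong (λ k → cong (λ b → indicator b ℚ.* Y w (suc k)) (M3adj-pendant t A v w i k)) ⟩
      sumℚ (λ k → indicator (same v w ∧ same (twin t i) k) ℚ.* Y w (suc k))
        ≡⟨ sumℚ-cong (λ k → trans (cong (ℚ._* Y w (suc k)) (indicator-∧ (same v w) _))
                                  (ℚP.*-assoc (δ w) _ _)) ⟩
      sumℚ (λ k → δ w ℚ.* (indicator (same (twin t i) k) ℚ.* Y w (suc k)))
        ≡⟨ sym (*-distribˡ-sumℚ (δ w) (λ k → indicator (same (twin t i) k) ℚ.* Y w (suc k))) ⟩
      δ w ℚ.* sumℚ (λ k → indicator (same (twin t i) k) ℚ.* Y w (suc k))
        ≡⟨ cong (δ w ℚ.*_) (sumℚ-same (twin t i) (Y w ∘ suc)) ⟩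
      δ w ℚ.* Y w (suc (twin t i)) ∎

  PendantBalanced : (Fin n → Fin m → ℚ) → Set
  PendantBalanced Y = ∀ v k → Y v (suc k) ≡ - Y v zero

  hubs : (Fin n → Fin m → ℚ) → Fin n → ℚ
  hubs Y v = Y v zero

  row-hub-balanced : IsRegular (2 * t) A → ∀ Y → PendantBalanced Y → ∀ v →
                     row (v , zero) Y ≡ - sumℚ (λ w → adjMatrix A v w ℚ.* (Y v zero - Y w zero))
  row-hub-balanced regular Y balanced v = begin
    row (v , zero) Y                                ≡⟨ row-hub v Y ⟩
    S + sumℚ (λ k → Y v (suc k))                    ≡⟨ cong (S +_) (sumℚ-cong (balanced v)) ⟩
    S + sumℚ {2 * t} (λ _ → - Y v zero)             ≡⟨ cong (S +_) (sumℚ-neg {2 * t} (λ _ → Y v zero)) ⟩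
    S - sumℚ {2 * t} (λ _ → Y v zero)               ≡⟨ solve 2 (λ s d → s :- d := :- (d :- s)) refl S _ ⟩
    - (sumℚ {2 * t} (λ _ → Y v zero) - S)           ≡⟨ cong -_ (sym (laplacian-regular regular (hubs Y) v)) ⟩
    - sumℚ (λ w → adjMatrix A v w ℚ.* (Y v zero - Y w zero)) ∎
    where
    open ≡-Reasoning
    open +-*-Solver
    S : ℚ
    S = sumℚ (λ w → adjMatrix A v w ℚ.* Y w zero)

  rows-vanish⇒balanced : ∀ Y → (∀ p → row p Y ≡ 0ℚ) → PendantBalanced Y
  rows-vanish⇒balanced Y rows≡0 v k = ℚGroup.inverseʳ-unique (Y v zero) (Y v (suc k)) (begin
    Y v zero + Y v (suc k)
      ≡⟨ cong (λ i → Y v zero + Y v (suc i)) (sym (twin-involutive t k)) ⟩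
    Y v zero + Y v (suc (twin t (twin t k)))
      ≡⟨ sym (row-pendant v (twin t k) Y) ⟩
    row (v , suc (twin t k)) Y
      ≡⟨ rows≡0 (v , suc (twin t k)) ⟩
    0ℚ ∎)
    where open ≡-Reasoning

  rows-vanish⇒harmonic : IsRegular (2 * t) A → ∀ Y → (∀ p → row p Y ≡ 0ℚ) → IsHarmonic A (hubs Y)
  rows-vanish⇒harmonic regular Y rows≡0 v = ℚP.neg-injective
    (trans (sym (row-hub-balanced regular Y (rows-vanish⇒balanced Y rows≡0) v)) (rows≡0 (v , zero)))

  balanced-harmonic⇒rows-vanish : IsRegular (2 * t) A → ∀ Y → PendantBalanced Y → IsHarmonic A (hubs Y) →
                                  ∀ p → row p Y ≡ 0ℚ
  balanced-harmonic⇒rows-vanish regular Y balanced harmonic (v , zero) =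
    trans (row-hub-balanced regular Y balanced v) (cong -_ (harmonic v))
  balanced-harmonic⇒rows-vanish regular Y balanced harmonic (v , suc i) =
    trans (row-pendant v i Y)
          (trans (cong (Y v zero +_) (balanced v (twin t i))) (ℚP.+-inverseʳ (Y v zero)))

  kernel⇒rows-vanish : ∀ {y} → InKernel (M3 t A) y → ∀ p → row p (λ w j → y (combine w j)) ≡ 0ℚ
  kernel⇒rows-vanish {y} y∈ker (v , i) = trans (sym (M3-row y v i)) (y∈ker (combine v i))

  rows-vanish⇒kernel : ∀ Y → (∀ p → row p Y ≡ 0ℚ) → InKernel (M3 t A) (uncurry Y ∘ remQuot {n} m)
  rows-vanish⇒kernel Y rows≡0 = ∀-combine λ v i → begin
    sumℚ (λ b → adjMatrix (M3 t A) (combine v i) b ℚ.* uncurry Y (remQuot {n} m b))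
      ≡⟨ M3-row (uncurry Y ∘ remQuot {n} m) v i ⟩
    row (v , i) (λ w j → uncurry Y (remQuot {n} m (combine w j)))
      ≡⟨ row-cong (v , i) (λ w j → cong (uncurry Y) (remQuot-combine w j)) ⟩
    row (v , i) Y
      ≡⟨ rows≡0 (v , i) ⟩
    0ℚ ∎
    where open ≡-Reasoning

  M3-nullVector : Fin (n * m) → ℚ
  M3-nullVector = uncurry (λ _ → hubSign) ∘ remQuot {n} m

  M3-nullVector-nonzero : ∀ u → ¬ M3-nullVector u ≡ 0ℚ
  M3-nullVector-nonzero u with proj₂ (remQuot {n} m u)
  ... | zero  = λ ()
  ... | suc _ = λ ()

  M3-nullVector-inKernel : IsRegular (2 * t) A → InKernel (M3 t A) M3-nullVector
  M3-nullVector-inKernel regular = rows-vanish⇒kernel (λ _ → hubSign)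
    (balanced-harmonic⇒rows-vanish regular (λ _ → hubSign) (λ _ _ → refl) (constant-harmonic A 1ℚ))

  kernel-multiple-of-nullVector : IsConnected A → IsRegular (2 * t) A → ∀ y → InKernel (M3 t A) y →
                                  ∀ v u → y u ≡ y (combine v zero) ℚ.* M3-nullVector u
  kernel-multiple-of-nullVector connected regular y y∈ker v u =
    trans (cong y (sym (combine-remQuot {n} m u))) (uncurry scaled (remQuot {n} m u))
    where
    Y : Fin n → Fin m → ℚ
    Y w j = y (combine w j)

    rows≡0 : ∀ p → row p Y ≡ 0ℚ
    rows≡0 = kernel⇒rows-vanish y∈ker

    hubs≡ : ∀ w w′ → Y w zero ≡ Y w′ zero
    hubs≡ = harmonic⇒constant connected (rows-vanish⇒harmonic regular Y rows≡0)

    scaled : ∀ w j → Y w j ≡ Y v zero ℚ.* hubSign j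
    scaled w zero    = trans (hubs≡ w v) (sym (ℚP.*-identityʳ (Y v zero)))
    scaled w (suc k) = begin
      Y w (suc k)             ≡⟨ rows-vanish⇒balanced Y rows≡0 w k ⟩
      - Y w zero              ≡⟨ cong -_ (hubs≡ w v) ⟩
      - Y v zero              ≡⟨ solve 1 (λ a → :- a := a :* :- con 1ℚ) refl (Y v zero) ⟩
      Y v zero ℚ.* - 1ℚ       ∎
      where
      open ≡-Reasoning
      open +-*-Solver

M3-kernel-spanned : ∀ t {n} (A : Adj n) → IsConnected A → IsRegular (2 * t) A →
                    ∀ y → InKernel (M3 t A) y → Σ ℚ λ c → ∀ u → y u ≡ c ℚ.* M3-nullVector t A u
M3-kernel-spanned t {zero}  A connected regular y y∈ker = 0ℚ , λ ()
M3-kernel-spanned t {suc n} A connected regular y y∈ker =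
  y (combine {suc n} {suc (2 * t)} zero zero) ,
  kernel-multiple-of-nullVector t A connected regular y y∈ker zero

proposition16 : (t : ℕ) → 1 ≤ t → (n : ℕ) → (A : Adj n) →
    IsSimple A → IsConnected A → IsRegular (2 * t) A →
    IsNut (M3 t A)
proposition16 t _ n A simple connected regular =
  M3-simple t A simple ,
  M3-connected t A connected ,
  M3-nullVector t A ,
  M3-nullVector-nonzero t A ,
  M3-nullVector-inKernel t A regular ,
  M3-kernel-spanned t A connected regular
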